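{- Fix natural numbers $k>r$ and a $3$-good list $L\subseteq\{0,1,\ldots,\binom{k}{r}\}$. Let $n$ and $a$ be natural numbers with $n>r-1>a$. Then $$d(a,n)\le\prod_{v=r}^{n}d(a+1,v).$$
   Context: An $r$-graph is an $r$-uniform hypergraph. An $r$-graph $G$ is $(L,k)$-free if for every $i\in L$ there is no set of $k$ vertices of $G$ spanning exactly $i$ edges. $L$ is $3$-good if $\{i,i+1,i+2\}\cap L\neq\emptyset$ for all $i\in\{0,\ldots,\binom{k}{r}-2\}$. Let $\mathcal{F}(n)$ be the family of $(L,k)$-free $r$-graphs on $[n]=\{1,\ldots,n\}$. For $A\subseteq[n]$ and $H\in\mathcal{F}(n)$, let $D(A,H,n)=\{G\in\mathcal{F}(n): A\subseteq e \text{ for all } e\in E(G)\,\triangle\, E(H)\}$, where $\triangle$ is symmetric difference. For $a\le n$, let $d(a,n)=\max\{|D(A,H,n)|: H\in\mathcal{F}(n)\}$, where $A$ is any $a$-element subset of $[n]$ (the value does not depend on the choice of $A$ since $\mathcal{F}(n)$ is closed under permutations of $[n]$). -}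

module Defs where

open import Data.Bool using (Bool; true; false; _∧_; _∨_; not; if_then_else_; _xor_)
import Data.Bool as B
open import Data.Nat using (ℕ; zero; suc; _+_; _*_; _∸_; _⊔_; _≡ᵇ_; _<ᵇ_; _≤_)
open import Data.Nat.Combinatorics using (_C_)
open import Data.Fin using (Fin; toℕ)
open import Data.List using (List; []; _∷_; _++_; map; filterᵇ; length; foldr; upTo)
open import Data.Bool.ListAction using (all; any)
open import Data.Nat.ListAction using (product)
open import Data.List.Membership.Propositional using (_∈_)
open import Data.List.Relation.Unary.All using (All)
open import Data.Product using (_×_)
open import Data.Sum using (_⊎_)
open import Data.Vec using (Vec; []; _∷_; tabulate)
import Data.Vec.Properties as VP
open import Relation.Nullary.Decidable using (⌊_⌋)

-- Subsets of [n] are represented as characteristic vectors Vec Bool n.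

Subset : ℕ → Set
Subset n = Vec Bool n

card : ∀ {n} → Subset n → ℕ
card []          = 0
card (true ∷ s)  = suc (card s)
card (false ∷ s) = card s

_⊆ᵇ_ : ∀ {n} → Subset n → Subset n → Bool
[] ⊆ᵇ [] = true
(x ∷ xs) ⊆ᵇ (y ∷ ys) = (not x ∨ y) ∧ (xs ⊆ᵇ ys)

_=ᵇ_ : ∀ {n} → Subset n → Subset n → Bool
s =ᵇ t = ⌊ VP.≡-dec B._≟_ s t ⌋

allSubsets : (n : ℕ) → List (Subset n)
allSubsets zero    = [] ∷ []
allSubsets (suc n) = map (false ∷_) (allSubsets n) ++ map (true ∷_) (allSubsets n)

subsetsOfSize : (n m : ℕ) → List (Subset n)
subsetsOfSize n m = filterᵇ (λ s → card s ≡ᵇ m) (allSubsets n)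

sublists : ∀ {A : Set} → List A → List (List A)
sublists []       = [] ∷ []
sublists (x ∷ xs) = sublists xs ++ map (x ∷_) (sublists xs)

-- r-graphs on [n]: a list of (distinct) r-element subsets of [n].

Graph : ℕ → Set
Graph n = List (Subset n)

allGraphs : (r n : ℕ) → List (Graph n)
allGraphs r n = sublists (subsetsOfSize n r)

_∈E_ : ∀ {n} → Subset n → Graph n → Bool
e ∈E G = any (λ f → e =ᵇ f) G

spanned : ∀ {n} → Graph n → Subset n → ℕ
spanned G S = length (filterᵇ (λ e → e ⊆ᵇ S) G)

isFree : (L : List ℕ) (k : ℕ) → ∀ {n} → Graph n → Bool
isFree L k {n} G =
  all (λ i → all (λ S → not (spanned G S ≡ᵇ i)) (subsetsOfSize n k)) L

𝓕 : (r k : ℕ) (L : List ℕ) (n : ℕ) → List (Graph n)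
𝓕 r k L n = filterᵇ (isFree L k) (allGraphs r n)

𝓓 : (r k : ℕ) (L : List ℕ) (n : ℕ) → Subset n → Graph n → List (Graph n)
𝓓 r k L n A H =
  filterᵇ (λ G → all (λ e → not ((e ∈E G) xor (e ∈E H)) ∨ (A ⊆ᵇ e))
                     (subsetsOfSize n r))
          (𝓕 r k L n)

maxList : List ℕ → ℕ
maxList = foldr _⊔_ 0

-- the canonical a-element subset {1,…,a} of [n] (first a vertices; a ≤ n)
initSeg : (n a : ℕ) → Subset n
initSeg n a = tabulate (λ (i : Fin n) → toℕ i <ᵇ a)

d : (r k : ℕ) (L : List ℕ) (a n : ℕ) → ℕ
d r k L a n = maxList (map (λ H → length (𝓓 r k L n (initSeg n a) H)) (𝓕 r k L n))

prodRange : ℕ → ℕ → (ℕ → ℕ) → ℕ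
prodRange lo hi f = product (map (λ j → f (lo + j)) (upTo (suc hi ∸ lo)))

ThreeGood : (k r : ℕ) → List ℕ → Set
ThreeGood k r L = ∀ i → i + 2 ≤ k C r → (i ∈ L ⊎ (suc i ∈ L ⊎ suc (suc i) ∈ L))

-- Deleting a vertex v ∉ A maps D(A, H, n+1) into D(A, H − v, n): a k-set avoiding v spans the
-- same edges before and after the deletion, so (L,k)-freeness survives, and every edge of the
-- symmetric difference still contains A. Two graphs with the same image agree on all edges
-- avoiding v, so each lies in D(A ∪ {v}, ·, n+1) of the other, and every fibre has at most
-- d(a+1, n+1) elements. Hence d(a, n+1) ≤ d(a, n) · d(a+1, n+1); iterating down to n = r − 1,
-- where there are no r-sets and so d(a, r − 1) ≤ 1, gives the product.

module Submission where

open import Algebra.Bundles using (CommutativeMonoid)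
import Algebra.Properties.CommutativeSemigroup as CommutativeSemigroup
open import Data.Bool as Bool using (Bool; true; false; T; T?; not; _∧_; _∨_; _xor_)
open import Data.Bool.ListAction using (all)
open import Data.Bool.Properties using (T-∧; ∧-zeroʳ; ∧-commutativeMonoid)
open import Data.Empty using (⊥-elim)
open import Data.Fin using (Fin; zero; suc; toℕ; fromℕ<)
open import Data.Fin.Properties using (toℕ-fromℕ<)
open import Data.List using (List; []; _∷_; _++_; map; filterᵇ; length; upTo)
open import Data.List.Membership.Propositional using (_∈_)
open import Data.List.Membership.Propositional.Properties
  using (∈-filter⁺; ∈-filter⁻; ∈-map⁺; ∈-map⁻; ∈-++⁺ˡ; ∈-++⁺ʳ; ∈-++⁻)
open import Data.List.Properties as List
  using (filter-++; length-++; length-filter; map-++; upTo-∷ʳ; filter-accept; filter-reject; filter-none)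
open import Data.List.Relation.Binary.Subset.Propositional using (_⊆_)
open import Data.List.Relation.Unary.All as All using (All; []; _∷_)
open import Data.List.Relation.Unary.All.Properties using (all⁺; all⁻)
open import Data.List.Relation.Unary.Any as Any using (here; there)
open import Data.List.Relation.Unary.Any.Properties using (any⁺; any⁻)
open import Data.List.Relation.Unary.Unique.Propositional using (Unique; []; _∷_)
import Data.List.Relation.Unary.Unique.Propositional.Properties as Unique
open import Data.Nat
  using (ℕ; zero; suc; _+_; _*_; _∸_; _≤_; _<_; _≤′_; ≤′-refl; ≤′-step; z≤n; s≤s; _≡ᵇ_)
open import Data.Nat.Combinatorics using (_C_)
open import Data.Nat.ListAction using (product)
open import Data.Nat.ListAction.Properties using (product-++)
open import Data.Nat.Properties
  using (≤-refl; ≤-trans; <⇒≤; <⇒≱; m≤n⇒m≤1+n; ≤′⇒≤; ≤⇒≤′; +-suc; +-identityʳ; +-mono-≤;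
         *-identityʳ; *-monoˡ-≤; m≤m⊔n; m≤n⊔m; ⊔-lub; n∸n≡0; +-∸-assoc; m+[n∸m]≡n;
         ≡ᵇ⇒≡; ≡⇒≡ᵇ; +-commutativeSemigroup; module ≤-Reasoning)
open import Data.Product using (_×_; _,_; proj₁; proj₂)
open import Data.Sum as Sum using (_⊎_; inj₁; inj₂; [_,_])
open import Data.Vec using ([]; _∷_; insertAt; removeAt; lookup)
open import Data.Vec.Properties as Vec using (∷-injectiveʳ; insertAt-removeAt)
open import Function using (id; _∘_; _⇔_; mk⇔; Equivalence)
open import Relation.Binary.Definitions using (DecidableEquality)
open import Relation.Binary.PropositionalEquality
  using (_≡_; _≢_; refl; sym; trans; cong; cong₂; subst; module ≡-Reasoning)
open import Relation.Nullary using (¬_)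
open import Relation.Nullary.Decidable using (⌊_⌋; toWitness; toWitnessFalse; fromWitness)

open import Defs

countᵇ : ∀ {A : Set} → (A → Bool) → List A → ℕ
countᵇ p xs = length (filterᵇ p xs)

module _ {A : Set} where

  filterᵇ-filterᵇ : ∀ (p q : A → Bool) xs →
    filterᵇ p (filterᵇ q xs) ≡ filterᵇ (λ x → q x ∧ p x) xs
  filterᵇ-filterᵇ p q []       = refl
  filterᵇ-filterᵇ p q (x ∷ xs) with q x
  ... | false = filterᵇ-filterᵇ p q xs
  ... | true with p x
  ...   | false = filterᵇ-filterᵇ p q xs
  ...   | true  = cong (x ∷_) (filterᵇ-filterᵇ p q xs)

  filterᵇ-cong : ∀ {p q : A → Bool} {xs} → (∀ {x} → x ∈ xs → p x ≡ q x) →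
    filterᵇ p xs ≡ filterᵇ q xs
  filterᵇ-cong {p} {q} {[]}     eq = refl
  filterᵇ-cong {p} {q} {x ∷ xs} eq with p x | q x | eq (here refl)
  ... | false | false | refl = filterᵇ-cong (eq ∘ there)
  ... | true  | true  | refl = cong (x ∷_) (filterᵇ-cong (eq ∘ there))

  countᵇ-cong : ∀ {p q : A → Bool} xs → (∀ x → p x ≡ q x) → countᵇ p xs ≡ countᵇ q xs
  countᵇ-cong xs eq = cong length (filterᵇ-cong {xs = xs} (λ {x} _ → eq x))

  countᵇ-++ : ∀ (p : A → Bool) xs ys → countᵇ p (xs ++ ys) ≡ countᵇ p xs + countᵇ p ys
  countᵇ-++ p xs ys = trans (cong length (filter-++ (T? ∘ p) xs ys)) (length-++ (filterᵇ p xs))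

  countᵇ-mono : ∀ {p q : A → Bool} xs → (∀ {x} → T (p x) → T (q x)) → countᵇ p xs ≤ countᵇ q xs
  countᵇ-mono {p} {q} []       p⇒q = z≤n
  countᵇ-mono {p} {q} (x ∷ xs) p⇒q with p x | q x | p⇒q {x}
  ... | false | false | _   = countᵇ-mono xs p⇒q
  ... | false | true  | _   = m≤n⇒m≤1+n (countᵇ-mono xs p⇒q)
  ... | true  | true  | _   = s≤s (countᵇ-mono xs p⇒q)
  ... | true  | false | p⇒q = ⊥-elim (p⇒q _)

  countᵇ-map : ∀ {B : Set} (p : B → Bool) (f : A → B) xs → countᵇ p (map f xs) ≡ countᵇ (p ∘ f) xs
  countᵇ-map p f []       = refl
  countᵇ-map p f (x ∷ xs) with p (f x)
  ... | false = countᵇ-map p f xs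
  ... | true  = cong suc (countᵇ-map p f xs)

  countᵇ-none : ∀ {p : A → Bool} xs → (∀ x → p x ≡ false) → countᵇ p xs ≡ 0
  countᵇ-none {p} []       none = refl
  countᵇ-none {p} (x ∷ xs) none with p x | none x
  ... | false | refl = countᵇ-none xs none

  countᵇ+countᵇ-not : ∀ (p : A → Bool) xs → countᵇ p xs + countᵇ (not ∘ p) xs ≡ length xs
  countᵇ+countᵇ-not p []       = refl
  countᵇ+countᵇ-not p (x ∷ xs) with p x
  ... | true  = cong suc (countᵇ+countᵇ-not p xs)
  ... | false = trans (+-suc _ _) (cong suc (countᵇ+countᵇ-not p xs))

  countᵇ-filterᵇ-≤ : ∀ (p q : A → Bool) xs → countᵇ p (filterᵇ q xs) ≤ countᵇ p xs
  countᵇ-filterᵇ-≤ p q xs = begin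
    countᵇ p (filterᵇ q xs)          ≡⟨ cong length (filterᵇ-filterᵇ p q xs) ⟩
    countᵇ (λ x → q x ∧ p x) xs     ≤⟨ countᵇ-mono xs (proj₂ ∘ Equivalence.to T-∧) ⟩
    countᵇ p xs                     ∎
    where open ≤-Reasoning

module _ {A : Set} (p : A → Bool) {xs : List A} where

  all-lookup : T (all p xs) → ∀ {x} → x ∈ xs → T (p x)
  all-lookup = All.lookup ∘ all⁺ p xs

  all-tabulate : (∀ {x} → x ∈ xs → T (p x)) → T (all p xs)
  all-tabulate = all⁻ p ∘ All.tabulate

module _ {A : Set} where

  filterᵇ-∈-sublists : ∀ (p : A → Bool) xs → filterᵇ p xs ∈ sublists xs
  filterᵇ-∈-sublists p []       = here refl
  filterᵇ-∈-sublists p (x ∷ xs) with p x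
  ... | false = ∈-++⁺ˡ (filterᵇ-∈-sublists p xs)
  ... | true  = ∈-++⁺ʳ (sublists xs) (∈-map⁺ (x ∷_) (filterᵇ-∈-sublists p xs))

  sublists-⊆ : ∀ {ys : List A} xs → ys ∈ sublists xs → ys ⊆ xs
  sublists-⊆ []       (here refl) ()
  sublists-⊆ (x ∷ xs) ys∈ y∈ys with ∈-++⁻ (sublists xs) ys∈
  ... | inj₁ ys∈xs = there (sublists-⊆ xs ys∈xs y∈ys)
  ... | inj₂ ys∈x∷ with ∈-map⁻ (x ∷_) ys∈x∷
  ...   | zs , zs∈ , refl with y∈ys
  ...     | here refl = here refl
  ...     | there y∈zs = there (sublists-⊆ xs zs∈ y∈zs)

module _ {A : Set} (f : A → ℕ) where

  ≤-maxList : ∀ {xs x} → x ∈ xs → f x ≤ maxList (map f xs)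
  ≤-maxList {y ∷ xs} (here refl) = m≤m⊔n (f y) _
  ≤-maxList {y ∷ xs} (there x∈) = ≤-trans (≤-maxList x∈) (m≤n⊔m (f y) _)

  maxList-≤ : ∀ xs {b} → (∀ {x} → x ∈ xs → f x ≤ b) → maxList (map f xs) ≤ b
  maxList-≤ []       f≤b = z≤n
  maxList-≤ (x ∷ xs) f≤b = ⊔-lub (f≤b (here refl)) (maxList-≤ xs (f≤b ∘ there))

module _ {A B : Set} (_≟_ : DecidableEquality B) (f : A → B) where

  inFibre : B → A → Bool
  inFibre y x = ⌊ f x ≟ y ⌋

  length≤length*maxFibre : ∀ m (ys : List B) (xs : List A) → (∀ {x} → x ∈ xs → f x ∈ ys) →
    (∀ {x} → x ∈ xs → countᵇ (inFibre (f x)) xs ≤ m) → length xs ≤ length ys * m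
  length≤length*maxFibre m []       []       _    _   = z≤n
  length≤length*maxFibre m []       (x ∷ xs) into _   with () ← into (here refl)
  length≤length*maxFibre m (y ∷ ys) xs       into fib = begin
    length xs                                 ≡⟨ countᵇ+countᵇ-not (inFibre y) xs ⟨
    countᵇ (inFibre y) xs + length rest
      ≤⟨ +-mono-≤ fibre-y≤m (length≤length*maxFibre m ys rest into-ys fib-rest) ⟩
    m + length ys * m                         ∎
    where
    open ≤-Reasoning
    rest : List A
    rest = filterᵇ (not ∘ inFibre y) xs

    -- A nonempty fibre over y is the fibre over f x for any of its members x.
    fibre-y≤m : countᵇ (inFibre y) xs ≤ m
    fibre-y≤m with filterᵇ (inFibre y) xs in eq
    ... | []    = z≤n
    ... | x ∷ _ with ∈-filter⁻ (T? ∘ inFibre y) {xs = xs} (subst (x ∈_) (sym eq) (here refl))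
    ...   | x∈xs , fx≡y = subst (λ l → length l ≤ m) eq
                            (subst (λ z → countᵇ (inFibre z) xs ≤ m) (toWitness fx≡y) (fib x∈xs))

    into-ys : ∀ {x} → x ∈ rest → f x ∈ ys
    into-ys x∈rest with ∈-filter⁻ (T? ∘ (not ∘ inFibre y)) {xs = xs} x∈rest
    ... | x∈xs , fx≢y with into x∈xs
    ...   | there fx∈ys = fx∈ys
    ...   | here  fx≡y  = ⊥-elim (toWitnessFalse fx≢y fx≡y)

    fib-rest : ∀ {x} → x ∈ rest → countᵇ (inFibre (f x)) rest ≤ m
    fib-rest {x} x∈rest = ≤-trans (countᵇ-filterᵇ-≤ (inFibre (f x)) _ xs)
                                  (fib (proj₁ (∈-filter⁻ (T? ∘ (not ∘ inFibre y)) {xs = xs} x∈rest)))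

T-injective : ∀ {x y : Bool} → (T x → T y) → (T y → T x) → x ≡ y
T-injective {false} {false} _ _ = refl
T-injective {false} {true}  _ y⇒x = ⊥-elim (y⇒x _)
T-injective {true}  {false} x⇒y _ = ⊥-elim (x⇒y _)
T-injective {true}  {true}  _ _ = refl

T-xnor-∨ : ∀ x y s → T (not (x xor y) ∨ s) ⇔ (x ≡ y ⊎ T s)
T-xnor-∨ true  true  s = mk⇔ (λ _ → inj₁ refl) (λ _ → _)
T-xnor-∨ false false s = mk⇔ (λ _ → inj₁ refl) (λ _ → _)
T-xnor-∨ true  false s = mk⇔ inj₂ [ (λ ()) , id ]
T-xnor-∨ false true  s = mk⇔ inj₂ [ (λ ()) , id ]

card-insertAt-false : ∀ {n} (v : Subset n) (i : Fin (suc n)) → card (insertAt v i false) ≡ card v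
card-insertAt-false v           zero    = refl
card-insertAt-false (true ∷ v)  (suc i) = cong suc (card-insertAt-false v i)
card-insertAt-false (false ∷ v) (suc i) = card-insertAt-false v i

⊆ᵇ-insertAt : ∀ {n} (u v : Subset n) (i : Fin (suc n)) (b c : Bool) →
  (insertAt u i b ⊆ᵇ insertAt v i c) ≡ ((not b ∨ c) ∧ (u ⊆ᵇ v))
⊆ᵇ-insertAt u       v       zero    b c = refl
⊆ᵇ-insertAt (x ∷ u) (y ∷ v) (suc i) b c =
  trans (cong ((not x ∨ y) ∧_) (⊆ᵇ-insertAt u v i b c)) (x∙yz≈y∙xz (not x ∨ y) (not b ∨ c) (u ⊆ᵇ v))
  where open CommutativeSemigroup (CommutativeMonoid.commutativeSemigroup ∧-commutativeMonoid)

initSeg-insertAt-false : ∀ {n} (i : Fin (suc n)) →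
  insertAt (initSeg n (toℕ i)) i false ≡ initSeg (suc n) (toℕ i)
initSeg-insertAt-false             zero    = refl
initSeg-insertAt-false {suc n} (suc i) = cong (true ∷_) (initSeg-insertAt-false i)

initSeg-insertAt-true : ∀ {n} (i : Fin (suc n)) →
  insertAt (initSeg n (toℕ i)) i true ≡ initSeg (suc n) (suc (toℕ i))
initSeg-insertAt-true             zero    = refl
initSeg-insertAt-true {suc n} (suc i) = cong (true ∷_) (initSeg-insertAt-true i)

initSeg-⊆ᵇ-insertAt : ∀ {n} (i : Fin (suc n)) (u : Subset n) (b : Bool) →
  (initSeg (suc n) (toℕ i) ⊆ᵇ insertAt u i b) ≡ (initSeg n (toℕ i) ⊆ᵇ u)
initSeg-⊆ᵇ-insertAt {n} i u b = begin
  initSeg (suc n) (toℕ i) ⊆ᵇ insertAt u i b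
    ≡⟨ cong (_⊆ᵇ insertAt u i b) (initSeg-insertAt-false i) ⟨
  insertAt (initSeg n (toℕ i)) i false ⊆ᵇ insertAt u i b
    ≡⟨ ⊆ᵇ-insertAt (initSeg n (toℕ i)) u i false b ⟩
  initSeg n (toℕ i) ⊆ᵇ u ∎
  where open ≡-Reasoning

initSeg-suc-⊆ᵇ-insertAt-true : ∀ {n} (i : Fin (suc n)) (u : Subset n) →
  (initSeg (suc n) (suc (toℕ i)) ⊆ᵇ insertAt u i true) ≡ (initSeg n (toℕ i) ⊆ᵇ u)
initSeg-suc-⊆ᵇ-insertAt-true {n} i u = begin
  initSeg (suc n) (suc (toℕ i)) ⊆ᵇ insertAt u i true
    ≡⟨ cong (_⊆ᵇ insertAt u i true) (initSeg-insertAt-true i) ⟨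
  insertAt (initSeg n (toℕ i)) i true ⊆ᵇ insertAt u i true
    ≡⟨ ⊆ᵇ-insertAt (initSeg n (toℕ i)) u i true true ⟩
  initSeg n (toℕ i) ⊆ᵇ u ∎
  where open ≡-Reasoning

∈-allSubsets : ∀ {n} (v : Subset n) → v ∈ allSubsets n
∈-allSubsets []          = here refl
∈-allSubsets (false ∷ v) = ∈-++⁺ˡ (∈-map⁺ (false ∷_) (∈-allSubsets v))
∈-allSubsets (true ∷ v)  = ∈-++⁺ʳ _ (∈-map⁺ (true ∷_) (∈-allSubsets v))

allSubsets-unique : ∀ n → Unique (allSubsets n)
allSubsets-unique zero    = [] ∷ []
allSubsets-unique (suc n) = Unique.++⁺ (Unique.map⁺ ∷-injectiveʳ (allSubsets-unique n))
                                       (Unique.map⁺ ∷-injectiveʳ (allSubsets-unique n))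
                                       headsDiffer
  where
  headsDiffer : ∀ {v} → ¬ (v ∈ map (false ∷_) (allSubsets n) × v ∈ map (true ∷_) (allSubsets n))
  headsDiffer (v∈false , v∈true) with ∈-map⁻ (false ∷_) v∈false | ∈-map⁻ (true ∷_) v∈true
  ... | _ , _ , refl | _ , _ , ()

countᵇ-allSubsets-suc : ∀ {n} (p : Subset (suc n) → Bool) →
  countᵇ p (allSubsets (suc n)) ≡
    countᵇ (p ∘ (false ∷_)) (allSubsets n) + countᵇ (p ∘ (true ∷_)) (allSubsets n)
countᵇ-allSubsets-suc {n} p =
  trans (countᵇ-++ p (map (false ∷_) (allSubsets n)) _)
        (cong₂ _+_ (countᵇ-map p _ (allSubsets n)) (countᵇ-map p _ (allSubsets n)))

countᵇ-allSubsets-insertAt : ∀ {n} (i : Fin (suc n)) (p : Subset (suc n) → Bool) →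
  countᵇ p (allSubsets (suc n)) ≡
    countᵇ (λ v → p (insertAt v i false)) (allSubsets n) +
    countᵇ (λ v → p (insertAt v i true)) (allSubsets n)
countᵇ-allSubsets-insertAt         zero    p = countᵇ-allSubsets-suc p
countᵇ-allSubsets-insertAt {suc n} (suc i) p = begin
  countᵇ p (allSubsets (suc (suc n)))
    ≡⟨ countᵇ-allSubsets-suc p ⟩
  countᵇ (p ∘ (false ∷_)) (allSubsets (suc n)) + countᵇ (p ∘ (true ∷_)) (allSubsets (suc n))
    ≡⟨ cong₂ _+_ (countᵇ-allSubsets-insertAt i (p ∘ (false ∷_)))
                 (countᵇ-allSubsets-insertAt i (p ∘ (true ∷_))) ⟩
  (count false false + count false true) + (count true false + count true true)
    ≡⟨ CommutativeSemigroup.interchange +-commutativeSemigroup (count false false) _ _ _ ⟩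
  (count false false + count true false) + (count false true + count true true)
    ≡⟨ cong₂ _+_ (countᵇ-allSubsets-suc {n} _) (countᵇ-allSubsets-suc {n} _) ⟨
  countᵇ (λ v → p (insertAt v (suc i) false)) (allSubsets (suc n)) +
    countᵇ (λ v → p (insertAt v (suc i) true)) (allSubsets (suc n)) ∎
  where
  open ≡-Reasoning
  count : Bool → Bool → ℕ
  count x b = countᵇ (λ v → p (x ∷ insertAt v i b)) (allSubsets n)

card≤ : ∀ {n} (v : Subset n) → card v ≤ n
card≤ []          = z≤n
card≤ (true ∷ v)  = s≤s (card≤ v)
card≤ (false ∷ v) = m≤n⇒m≤1+n (card≤ v)

module _ {n m : ℕ} where

  ∈-subsetsOfSize⁺ : ∀ {v : Subset n} → card v ≡ m → v ∈ subsetsOfSize n m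
  ∈-subsetsOfSize⁺ {v} eq = ∈-filter⁺ (T? ∘ λ s → card s ≡ᵇ m) (∈-allSubsets v) (≡⇒≡ᵇ _ _ eq)

  ∈-subsetsOfSize⁻ : ∀ {v : Subset n} → v ∈ subsetsOfSize n m → card v ≡ m
  ∈-subsetsOfSize⁻ v∈ = ≡ᵇ⇒≡ _ _ (proj₂ (∈-filter⁻ (T? ∘ λ s → card s ≡ᵇ m) {xs = allSubsets n} v∈))

  subsetsOfSize-unique : Unique (subsetsOfSize n m)
  subsetsOfSize-unique = Unique.filter⁺ (T? ∘ λ s → card s ≡ᵇ m) {xs = allSubsets n} (allSubsets-unique n)

  subsetsOfSize-empty : n < m → subsetsOfSize n m ≡ []
  subsetsOfSize-empty n<m = filter-none (T? ∘ λ s → card s ≡ᵇ m)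
    (All.universal (λ v v∈ → <⇒≱ n<m (subst (_≤ n) (≡ᵇ⇒≡ _ _ v∈) (card≤ v))) (allSubsets n))

module _ {n m : ℕ} (i : Fin (suc n)) where

  insertAt-∈-subsetsOfSize : ∀ {v : Subset n} → v ∈ subsetsOfSize n m → insertAt v i false ∈ subsetsOfSize (suc n) m
  insertAt-∈-subsetsOfSize {v} v∈ = ∈-subsetsOfSize⁺ (trans (card-insertAt-false v i) (∈-subsetsOfSize⁻ v∈))

  insertAt-∈-subsetsOfSize⁻ : ∀ {v : Subset n} → insertAt v i false ∈ subsetsOfSize (suc n) m → v ∈ subsetsOfSize n m
  insertAt-∈-subsetsOfSize⁻ {v} v∈ = ∈-subsetsOfSize⁺ (trans (sym (card-insertAt-false v i)) (∈-subsetsOfSize⁻ v∈))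

  countᵇ-subsetsOfSize-insertAt : ∀ (p : Subset (suc n) → Bool) → (∀ v → p (insertAt v i true) ≡ false) →
    countᵇ p (subsetsOfSize (suc n) m) ≡ countᵇ (λ v → p (insertAt v i false)) (subsetsOfSize n m)
  countᵇ-subsetsOfSize-insertAt p p-true≡false = begin
    countᵇ p (subsetsOfSize (suc n) m)
      ≡⟨ cong length (filterᵇ-filterᵇ p hasSize (allSubsets (suc n))) ⟩
    countᵇ (λ v → hasSize v ∧ p v) (allSubsets (suc n))
      ≡⟨ countᵇ-allSubsets-insertAt i _ ⟩
    countᵇ (λ v → hasSize (insertAt v i false) ∧ p (insertAt v i false)) (allSubsets n) +
      countᵇ (λ v → hasSize (insertAt v i true) ∧ p (insertAt v i true)) (allSubsets n)
      ≡⟨ cong₂ _+_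
           (countᵇ-cong (allSubsets n) (λ v →
              cong (λ c → (c ≡ᵇ m) ∧ p (insertAt v i false)) (card-insertAt-false v i)))
           (countᵇ-none (allSubsets n) (λ v → trans (cong (_ ∧_) (p-true≡false v)) (∧-zeroʳ _))) ⟩
    countᵇ (λ v → hasSize v ∧ p (insertAt v i false)) (allSubsets n) + 0
      ≡⟨ +-identityʳ _ ⟩
    countᵇ (λ v → hasSize v ∧ p (insertAt v i false)) (allSubsets n)
      ≡⟨ cong length (filterᵇ-filterᵇ _ hasSize (allSubsets n)) ⟨
    countᵇ (λ v → p (insertAt v i false)) (subsetsOfSize n m) ∎
    where
    open ≡-Reasoning
    hasSize : ∀ {l} → Subset l → Bool
    hasSize v = card v ≡ᵇ m

module _ {n : ℕ} {e : Subset n} where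

  ∈E⇒∈ : ∀ {G : Graph n} → T (e ∈E G) → e ∈ G
  ∈E⇒∈ {G} e∈EG = Any.map toWitness (any⁻ (e =ᵇ_) G e∈EG)

  ∈⇒∈E : ∀ {G : Graph n} → e ∈ G → T (e ∈E G)
  ∈⇒∈E e∈G = any⁺ (e =ᵇ_) (Any.map fromWitness e∈G)

  ∈E-∷-≢ : ∀ {f} {G : Graph n} → e ≢ f → (e ∈E (f ∷ G)) ≡ (e ∈E G)
  ∈E-∷-≢ {f} {G} e≢f =
    T-injective (∈⇒∈E {G} ∘ Any.tail e≢f ∘ ∈E⇒∈ {f ∷ G}) (∈⇒∈E {f ∷ G} ∘ there ∘ ∈E⇒∈ {G})

_≟ᴳ_ : ∀ {n} → DecidableEquality (Graph n)
_≟ᴳ_ = List.≡-dec (Vec.≡-dec Bool._≟_)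

filterᵇ-∈E-sublist : ∀ {n} {G : Graph n} xs → Unique xs → G ∈ sublists xs → filterᵇ (_∈E G) xs ≡ G
filterᵇ-∈E-sublist []       []             (here refl) = refl
filterᵇ-∈E-sublist {G = G} (x ∷ xs) (x≢xs ∷ xs-unique) G∈ with ∈-++⁻ (sublists xs) G∈
... | inj₁ G∈xs = trans
  (filter-reject (T? ∘ (_∈E G)) (λ x∈EG → All.lookup x≢xs (sublists-⊆ xs G∈xs (∈E⇒∈ {G = G} x∈EG)) refl))
  (filterᵇ-∈E-sublist xs xs-unique G∈xs)
... | inj₂ G∈x∷ with ∈-map⁻ (x ∷_) G∈x∷
...   | H , H∈xs , refl = trans
  (filter-accept (T? ∘ (_∈E G)) (∈⇒∈E {G = G} (here refl)))
  (cong (x ∷_) (trans (filterᵇ-cong (λ e∈xs → ∈E-∷-≢ {G = H} (λ e≡x → All.lookup x≢xs e∈xs (sym e≡x))))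
                      (filterᵇ-∈E-sublist xs xs-unique H∈xs)))

module _ (r k : ℕ) (L : List ℕ) where

  -- The subgraph induced on [n+1] ∖ {i}, the vertices after i shifted down by one.
  deleteVertex : ∀ {n} → Fin (suc n) → Graph (suc n) → Graph n
  deleteVertex {n} i G = filterᵇ (λ e → insertAt e i false ∈E G) (subsetsOfSize n r)

  spanned≡countᵇ : ∀ {n} {G : Graph n} → G ∈ allGraphs r n → ∀ S →
    spanned G S ≡ countᵇ (λ e → (e ∈E G) ∧ (e ⊆ᵇ S)) (subsetsOfSize n r)
  spanned≡countᵇ {n} {G} G∈ S = begin
    countᵇ (_⊆ᵇ S) G
      ≡⟨ cong (countᵇ (_⊆ᵇ S))
              (filterᵇ-∈E-sublist (subsetsOfSize n r) (subsetsOfSize-unique {n} {r}) G∈) ⟨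
    countᵇ (_⊆ᵇ S) (filterᵇ (_∈E G) (subsetsOfSize n r))
      ≡⟨ cong length (filterᵇ-filterᵇ (_⊆ᵇ S) (_∈E G) (subsetsOfSize n r)) ⟩
    countᵇ (λ e → (e ∈E G) ∧ (e ⊆ᵇ S)) (subsetsOfSize n r) ∎
    where open ≡-Reasoning

  module _ {n : ℕ} (i : Fin (suc n)) where

    ∈E-deleteVertex : ∀ {G : Graph (suc n)} {e} → e ∈ subsetsOfSize n r →
      (e ∈E deleteVertex i G) ≡ (insertAt e i false ∈E G)
    ∈E-deleteVertex {G} e∈ = T-injective
      (proj₂ ∘ ∈-filter⁻ (T? ∘ λ e → insertAt e i false ∈E G) {xs = subsetsOfSize n r}
             ∘ ∈E⇒∈ {G = deleteVertex i G})
      (∈⇒∈E {G = deleteVertex i G} ∘ ∈-filter⁺ (T? ∘ λ e → insertAt e i false ∈E G) e∈)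

    spanned-deleteVertex : ∀ {G : Graph (suc n)} → G ∈ allGraphs r (suc n) → ∀ S →
      spanned (deleteVertex i G) S ≡ spanned G (insertAt S i false)
    spanned-deleteVertex {G} G∈ S = begin
      spanned (deleteVertex i G) S
        ≡⟨ cong length (filterᵇ-filterᵇ (_⊆ᵇ S) _ (subsetsOfSize n r)) ⟩
      countᵇ (λ e → (insertAt e i false ∈E G) ∧ (e ⊆ᵇ S)) (subsetsOfSize n r)
        ≡⟨ countᵇ-cong (subsetsOfSize n r) (λ e → cong (_ ∧_) (⊆ᵇ-insertAt e S i false false)) ⟨
      countᵇ (λ e → (insertAt e i false ∈E G) ∧ (insertAt e i false ⊆ᵇ insertAt S i false)) (subsetsOfSize n r)
        ≡⟨ countᵇ-subsetsOfSize-insertAt i _ noEdgeThrough ⟨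
      countᵇ (λ e → (e ∈E G) ∧ (e ⊆ᵇ insertAt S i false)) (subsetsOfSize (suc n) r)
        ≡⟨ spanned≡countᵇ G∈ (insertAt S i false) ⟨
      spanned G (insertAt S i false) ∎
      where
      open ≡-Reasoning
      noEdgeThrough : ∀ e → ((insertAt e i true ∈E G) ∧ (insertAt e i true ⊆ᵇ insertAt S i false)) ≡ false
      noEdgeThrough e = trans (cong (_ ∧_) (⊆ᵇ-insertAt e S i true false)) (∧-zeroʳ _)

    deleteVertex-∈𝓕 : ∀ {G} → G ∈ 𝓕 r k L (suc n) → deleteVertex i G ∈ 𝓕 r k L n
    deleteVertex-∈𝓕 {G} G∈𝓕 with ∈-filter⁻ (T? ∘ isFree L k) {xs = allGraphs r (suc n)} G∈𝓕
    ... | G∈ , G-free = ∈-filter⁺ (T? ∘ isFree L k) (filterᵇ-∈-sublists _ (subsetsOfSize n r))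
      (all-tabulate (avoids (deleteVertex i G)) {xs = L} λ {j} j∈L → all-tabulate _ λ {S} S∈ →
        subst (λ s → T (not (s ≡ᵇ j))) (sym (spanned-deleteVertex G∈ S))
          (all-lookup _ {xs = subsetsOfSize (suc n) k} (all-lookup (avoids G) {xs = L} G-free j∈L)
                      (insertAt-∈-subsetsOfSize i S∈)))
      where
      avoids : ∀ {l} → Graph l → ℕ → Bool
      avoids {l} H j = all (λ S → not (spanned H S ≡ᵇ j)) (subsetsOfSize l k)

  differsAboveᵇ : ∀ {n} → Subset n → Graph n → Graph n → Bool
  differsAboveᵇ {n} A H G = all (λ e → not ((e ∈E G) xor (e ∈E H)) ∨ (A ⊆ᵇ e)) (subsetsOfSize n r)

  DiffersAbove : ∀ {n} → Subset n → Graph n → Graph n → Set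
  DiffersAbove {n} A H G = ∀ e → e ∈ subsetsOfSize n r → (e ∈E G) ≡ (e ∈E H) ⊎ T (A ⊆ᵇ e)

  module _ {n : ℕ} (A : Subset n) where

    T-differsAboveᵇ : ∀ H G → T (differsAboveᵇ A H G) ⇔ DiffersAbove A H G
    T-differsAboveᵇ H G = mk⇔
      (λ t e e∈ → Equivalence.to (T-xnor-∨ _ _ _)
                    (all-lookup (edgeTest {H} {G}) {xs = subsetsOfSize n r} t e∈))
      (λ diff → all-tabulate (edgeTest {H} {G}) (λ {e} e∈ → Equivalence.from (T-xnor-∨ _ _ _) (diff e e∈)))
      where
      edgeTest : ∀ {H G} → Subset n → Bool
      edgeTest {H} {G} e = not ((e ∈E G) xor (e ∈E H)) ∨ (A ⊆ᵇ e)

    ∈𝓓⇔ : ∀ H G → G ∈ 𝓓 r k L n A H ⇔ (G ∈ 𝓕 r k L n × DiffersAbove A H G)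
    ∈𝓓⇔ H G = mk⇔
      (λ G∈ → let G∈𝓕 , t = ∈-filter⁻ (T? ∘ differsAboveᵇ A H) {xs = 𝓕 r k L n} G∈
              in G∈𝓕 , Equivalence.to (T-differsAboveᵇ H G) t)
      (λ G∈×diff → ∈-filter⁺ (T? ∘ differsAboveᵇ A H) (proj₁ G∈×diff)
                    (Equivalence.from (T-differsAboveᵇ H G) (proj₂ G∈×diff)))

  module _ {n : ℕ} {A : Subset n} where

    differsAbove-sym : ∀ {H G} → DiffersAbove A H G → DiffersAbove A G H
    differsAbove-sym diff e e∈ = Sum.map₁ sym (diff e e∈)

    differsAbove-trans : ∀ {G₁ G₂ G₃} → DiffersAbove A G₁ G₂ → DiffersAbove A G₂ G₃ → DiffersAbove A G₁ G₃
    differsAbove-trans diff₁₂ diff₂₃ e e∈ with diff₁₂ e e∈ | diff₂₃ e e∈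
    ... | inj₁ eq₁₂ | inj₁ eq₂₃ = inj₁ (trans eq₂₃ eq₁₂)
    ... | inj₂ A⊆e  | _         = inj₂ A⊆e
    ... | _         | inj₂ A⊆e  = inj₂ A⊆e

  module _ {n : ℕ} (i : Fin (suc n)) where

    deleteVertex-differsAbove : ∀ {H G} → DiffersAbove (initSeg (suc n) (toℕ i)) H G →
      DiffersAbove (initSeg n (toℕ i)) (deleteVertex i H) (deleteVertex i G)
    deleteVertex-differsAbove {H} {G} diff e e∈ =
      Sum.map (λ eq → trans (∈E-deleteVertex i {G} e∈) (trans eq (sym (∈E-deleteVertex i {H} e∈))))
              (subst T (initSeg-⊆ᵇ-insertAt i e false))
              (diff (insertAt e i false) (insertAt-∈-subsetsOfSize i e∈))

    deleteVertex-∈𝓓 : ∀ {H G} → G ∈ 𝓓 r k L (suc n) (initSeg (suc n) (toℕ i)) H →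
      deleteVertex i G ∈ 𝓓 r k L n (initSeg n (toℕ i)) (deleteVertex i H)
    deleteVertex-∈𝓓 {H} {G} G∈ with Equivalence.to (∈𝓓⇔ (initSeg (suc n) (toℕ i)) H G) G∈
    ... | G∈𝓕 , diff = Equivalence.from (∈𝓓⇔ (initSeg n (toℕ i)) (deleteVertex i H) (deleteVertex i G))
                          (deleteVertex-∈𝓕 i G∈𝓕 , deleteVertex-differsAbove {H} {G} diff)

    differsAbove-suc : ∀ {G₀ G} → DiffersAbove (initSeg (suc n) (toℕ i)) G₀ G →
      deleteVertex i G ≡ deleteVertex i G₀ → DiffersAbove (initSeg (suc n) (suc (toℕ i))) G₀ G
    differsAbove-suc {G₀} {G} diff del≡ e e∈ =
      subst Goal (insertAt-removeAt e i)
        (atInsertion (removeAt e i) (lookup e i) (subst (_∈ _) (sym (insertAt-removeAt e i)) e∈))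
      where
      Goal : Subset (suc n) → Set
      Goal e = (e ∈E G) ≡ (e ∈E G₀) ⊎ T (initSeg (suc n) (suc (toℕ i)) ⊆ᵇ e)
      atInsertion : ∀ u b → insertAt u i b ∈ subsetsOfSize (suc n) r → Goal (insertAt u i b)
      atInsertion u false u∈ = inj₁ (begin
        insertAt u i false ∈E G  ≡⟨ ∈E-deleteVertex i {G} (insertAt-∈-subsetsOfSize⁻ i u∈) ⟨
        u ∈E deleteVertex i G    ≡⟨ cong (u ∈E_) del≡ ⟩
        u ∈E deleteVertex i G₀   ≡⟨ ∈E-deleteVertex i {G₀} (insertAt-∈-subsetsOfSize⁻ i u∈) ⟩
        insertAt u i false ∈E G₀ ∎)
        where open ≡-Reasoning
      atInsertion u true u∈ =
        Sum.map₂ (subst T (trans (initSeg-⊆ᵇ-insertAt i u true) (sym (initSeg-suc-⊆ᵇ-insertAt-true i u))))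
                 (diff (insertAt u i true) u∈)

    deleteVertex-fibre-≤ : ∀ {H G₀} → G₀ ∈ 𝓓 r k L (suc n) (initSeg (suc n) (toℕ i)) H →
      countᵇ (inFibre _≟ᴳ_ (deleteVertex i) (deleteVertex i G₀))
             (𝓓 r k L (suc n) (initSeg (suc n) (toℕ i)) H)
        ≤ d r k L (suc (toℕ i)) (suc n)
    deleteVertex-fibre-≤ {H} {G₀} G₀∈ = begin
      countᵇ sameFibre (filterᵇ (differsAboveᵇ A H) graphs)
        ≡⟨ cong length (filterᵇ-filterᵇ sameFibre (differsAboveᵇ A H) graphs) ⟩
      countᵇ (λ G → differsAboveᵇ A H G ∧ sameFibre G) graphs
        ≤⟨ countᵇ-mono graphs (λ {G} → differsAbove⁺ G ∘ Equivalence.to T-∧) ⟩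
      countᵇ (differsAboveᵇ A⁺ G₀) graphs
        ≤⟨ ≤-maxList (λ H → length (𝓓 r k L (suc n) A⁺ H)) G₀∈𝓕 ⟩
      d r k L (suc (toℕ i)) (suc n) ∎
      where
      open ≤-Reasoning
      A A⁺ : Subset (suc n)
      A  = initSeg (suc n) (toℕ i)
      A⁺ = initSeg (suc n) (suc (toℕ i))
      graphs : List (Graph (suc n))
      graphs = 𝓕 r k L (suc n)
      sameFibre : Graph (suc n) → Bool
      sameFibre = inFibre _≟ᴳ_ (deleteVertex i) (deleteVertex i G₀)
      G₀∈𝓕 : G₀ ∈ graphs
      G₀∈𝓕 = proj₁ (Equivalence.to (∈𝓓⇔ A H G₀) G₀∈)
      differsAbove⁺ : ∀ G → T (differsAboveᵇ A H G) × T (sameFibre G) → T (differsAboveᵇ A⁺ G₀ G)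
      differsAbove⁺ G (diff , same) = Equivalence.from (T-differsAboveᵇ A⁺ G₀ G)
        (differsAbove-suc {G₀} {G}
          (differsAbove-trans {A = A} {G₀} {H} {G}
            (differsAbove-sym {A = A} {H} {G₀} (proj₂ (Equivalence.to (∈𝓓⇔ A H G₀) G₀∈)))
            (Equivalence.to (T-differsAboveᵇ A H G) diff))
          (toWitness same))

    -- Vertex toℕ i is the first one outside A = initSeg (suc n) (toℕ i), and adding it to A gives
    -- the next initial segment.
    d-suc-≤-vertex : d r k L (toℕ i) (suc n) ≤ d r k L (toℕ i) n * d r k L (suc (toℕ i)) (suc n)
    d-suc-≤-vertex = maxList-≤ (λ H → length (𝓓 r k L (suc n) A H)) (𝓕 r k L (suc n)) λ {H} H∈ → begin
      length (𝓓 r k L (suc n) A H)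
        ≤⟨ length≤length*maxFibre _≟ᴳ_ (deleteVertex i) _ (𝓓 r k L n A⁻ (deleteVertex i H)) _
             (deleteVertex-∈𝓓 {H}) (deleteVertex-fibre-≤ {H}) ⟩
      length (𝓓 r k L n A⁻ (deleteVertex i H)) * d r k L (suc (toℕ i)) (suc n)
        ≤⟨ *-monoˡ-≤ _ (≤-maxList (λ H → length (𝓓 r k L n A⁻ H)) (deleteVertex-∈𝓕 i H∈)) ⟩
      d r k L (toℕ i) n * d r k L (suc (toℕ i)) (suc n) ∎
      where
      open ≤-Reasoning
      A : Subset (suc n)
      A = initSeg (suc n) (toℕ i)
      A⁻ : Subset n
      A⁻ = initSeg n (toℕ i)

  d-suc-≤ : ∀ {a n} → a ≤ n → d r k L a (suc n) ≤ d r k L a n * d r k L (suc a) (suc n)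
  d-suc-≤ {a} {n} a≤n = subst (λ a → d r k L a (suc n) ≤ d r k L a n * d r k L (suc a) (suc n))
                              (toℕ-fromℕ< (s≤s a≤n)) (d-suc-≤-vertex (fromℕ< (s≤s a≤n)))

  d≤1 : ∀ a {n} → n < r → d r k L a n ≤ 1
  d≤1 a {n} n<r = maxList-≤ (λ H → length (𝓓 r k L n (initSeg n a) H)) (𝓕 r k L n) λ {H} _ → begin
    length (𝓓 r k L n (initSeg n a) H)  ≤⟨ length-filter (T? ∘ differsAboveᵇ (initSeg n a) H) (𝓕 r k L n) ⟩
    length (𝓕 r k L n)                  ≤⟨ length-filter (T? ∘ isFree L k) (allGraphs r n) ⟩
    length (allGraphs r n)              ≡⟨ cong (length ∘ sublists) (subsetsOfSize-empty n<r) ⟩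
    1                                   ∎
    where open ≤-Reasoning

prodRange-empty : ∀ lo (f : ℕ → ℕ) → prodRange (suc lo) lo f ≡ 1
prodRange-empty lo f = cong (λ m → product (map (λ j → f (suc lo + j)) (upTo m))) (n∸n≡0 lo)

prodRange-suc : ∀ lo hi (f : ℕ → ℕ) → lo ≤ suc hi →
  prodRange lo (suc hi) f ≡ prodRange lo hi f * f (suc hi)
prodRange-suc lo hi f lo≤ = begin
  product (map g (upTo (suc (suc hi) ∸ lo)))  ≡⟨ cong (product ∘ map g ∘ upTo) (+-∸-assoc 1 lo≤) ⟩
  product (map g (upTo (suc m)))              ≡⟨ cong (product ∘ map g) (upTo-∷ʳ m) ⟨
  product (map g (upTo m ++ m ∷ []))          ≡⟨ cong product (map-++ g (upTo m) (m ∷ [])) ⟩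
  product (map g (upTo m) ++ g m ∷ [])        ≡⟨ product-++ (map g (upTo m)) (g m ∷ []) ⟩
  product (map g (upTo m)) * (g m * 1)        ≡⟨ cong (λ x → product (map g (upTo m)) * x) (*-identityʳ (g m)) ⟩
  product (map g (upTo m)) * f (lo + m)       ≡⟨ cong (λ x → product (map g (upTo m)) * f x) (m+[n∸m]≡n lo≤) ⟩
  product (map g (upTo m)) * f (suc hi)       ∎
  where
  open ≡-Reasoning
  g : ℕ → ℕ
  g j = f (lo + j)
  m : ℕ
  m = suc hi ∸ lo

d≤prodRange : ∀ r k L a {n} → a ≤ r → r ≤′ n →
  d (suc r) k L a n ≤ prodRange (suc r) n (d (suc r) k L (suc a))
d≤prodRange r k L a a≤r ≤′-refl =
  subst (d (suc r) k L a r ≤_) (sym (prodRange-empty r (d (suc r) k L (suc a)))) (d≤1 (suc r) k L a ≤-refl)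
d≤prodRange r k L a {suc n} a≤r (≤′-step r≤′n) = begin
  d (suc r) k L a (suc n)                 ≤⟨ d-suc-≤ (suc r) k L (≤-trans a≤r (≤′⇒≤ r≤′n)) ⟩
  d (suc r) k L a n * F (suc n)           ≤⟨ *-monoˡ-≤ (F (suc n)) (d≤prodRange r k L a a≤r r≤′n) ⟩
  prodRange (suc r) n F * F (suc n)       ≡⟨ prodRange-suc (suc r) n F (s≤s (≤′⇒≤ r≤′n)) ⟨
  prodRange (suc r) (suc n) F             ∎
  where
  open ≤-Reasoning
  F : ℕ → ℕ
  F = d (suc r) k L (suc a)

lemma3p2 : (k r : ℕ) (L : List ℕ) → r < k →
    All (λ i → i ≤ k C r) L → ThreeGood k r L →
    (n a : ℕ) → r ∸ 1 < n → a < r ∸ 1 →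
    d r k L a n ≤ prodRange r n (λ v → d r k L (suc a) v)
lemma3p2 k zero    L _ _ _ n a _   ()
lemma3p2 k (suc r) L _ _ _ n a r<n a<r = d≤prodRange r k L a (<⇒≤ a<r) (≤⇒≤′ (<⇒≤ r<n))
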